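{- Let $0<\varepsilon<1$ and $\kappa>0$ with $\kappa<\min\left(\frac{1-2\varepsilon}{3},1-4\varepsilon\right)$. If the connected multigraph $G$ satisfies $\mathrm{vol}_G(\mathbf{Isol}^+_\kappa(G))\le\varepsilon\,\mathrm{vol}(G)$, then $\mathbf{Isol}_{\kappa^2}(G)\subset\mathbf{Isol}^+_\kappa(G)$, and in particular $\mathrm{vol}_G(\mathbf{Isol}_{\kappa^2}(G))\le\varepsilon\,\mathrm{vol}(G)$.
   Context: Multigraphs may have loops and multiple edges. For $X,Y\subset V(G)$, $e_G(X,Y)$ is the number of oriented edges starting in $X$ and ending in $Y$; $\deg_G(x)=e_G(\{x\},V(G)\setminus\{x\})$; $\mathrm{vol}_G(X)=\sum_{x\in X}\deg_G(x)$, $\mathrm{vol}(G)=\mathrm{vol}_G(V(G))$. For $\kappa>0$, a set $X\subset V(G)$ is a $\kappa$-bad set if the subgraph induced by $X$ is connected, $\mathrm{vol}_G(X)\le\mathrm{vol}(G)/2$ and $e_G(X,V(G)\setminus X)/\mathrm{vol}_G(X)<\kappa$; it is a strong $\kappa$-bad set if moreover the subgraph induced by $V(G)\setminus X$ is connected. A vertex is $\kappa$-isolated (resp. strongly $\kappa$-isolated) if it belongs to some $\kappa$-bad set (resp. strong $\kappa$-bad set); $\mathbf{Isol}_\kappa(G)$ (resp. $\mathbf{Isol}^+_\kappa(G)$) denotes the set of such vertices.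
   Formalization: The parameters ε and κ range over the rationals. -}

module Defs where

open import Data.Nat using (ℕ)
open import Data.Bool using (Bool; true; false; _∧_; not)
open import Data.Fin using (Fin)
open import Data.Fin.Subset using (Subset; _∈_; _∉_; ⁅_⁆; ∁; ⊤)
open import Data.Vec using (lookup)
open import Data.List using (List; []; _∷_; concatMap; filterᵇ; length; map)
open import Data.Nat.ListAction using (sum)
open import Data.List.Membership.Propositional renaming (_∈_ to _∈ₗ_)
open import Data.Fin.Base using () 
open import Data.List using (allFin)
open import Data.Product using (_×_; _,_; Σ; ∃)
open import Data.Sum using (_⊎_)
open import Data.Integer using (+_)
open import Data.Rational using (ℚ; _/_; _*_; _<_; _≤_)

-- A finite multigraph on the vertex set Fin n: a list of (unoriented) edges;
-- loops (u , u) and repeated edges are allowed.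
record Multigraph (n : ℕ) : Set where
  constructor mkGraph
  field
    edges : List (Fin n × Fin n)
open Multigraph public

orientedEdges : ∀ {n} → Multigraph n → List (Fin n × Fin n)
orientedEdges G = concatMap (λ { (u , v) → (u , v) ∷ (v , u) ∷ [] }) (edges G)

mem : ∀ {n} → Subset n → Fin n → Bool
mem S x = lookup S x

eG : ∀ {n} → Multigraph n → Subset n → Subset n → ℕ
eG G X Y = length (filterᵇ (λ { (a , b) → mem X a ∧ mem Y b }) (orientedEdges G))

deg : ∀ {n} → Multigraph n → Fin n → ℕ
deg G x = eG G ⁅ x ⁆ (∁ ⁅ x ⁆)

vol : ∀ {n} → Multigraph n → Subset n → ℕ
vol G X = sum (map (deg G) (filterᵇ (mem X) (allFin _)))

volG : ∀ {n} → Multigraph n → ℕ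
volG G = vol G ⊤

Adj : ∀ {n} → Multigraph n → Fin n → Fin n → Set
Adj G u v = (u , v) ∈ₗ edges G ⊎ (v , u) ∈ₗ edges G

data Reach {n} (G : Multigraph n) (X : Subset n) : Fin n → Fin n → Set where
  here : ∀ {x} → Reach G X x x
  step : ∀ {x y z} → Adj G x y → y ∈ X → Reach G X y z → Reach G X x z

InducedConnected : ∀ {n} → Multigraph n → Subset n → Set
InducedConnected G X = ∀ x y → x ∈ X → y ∈ X → Reach G X x y

Connected : ∀ {n} → Multigraph n → Set
Connected G = InducedConnected G ⊤

ℕtoℚ : ℕ → ℚ
ℕtoℚ k = (+ k) / 1

-- X is κ-bad: induced subgraph connected, vol(X) ≤ vol(G)/2, and
-- e(X, V∖X)/vol(X) < κ (written as e(X,V∖X) < κ·vol(X), so vol(X) > 0 is forced).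
Bad : ∀ {n} → Multigraph n → ℚ → Subset n → Set
Bad G κ X = InducedConnected G X
          × ℕtoℚ (vol G X) * ℕtoℚ 2 ≤ ℕtoℚ (volG G)
          × ℕtoℚ (eG G X (∁ X)) < κ * ℕtoℚ (vol G X)

StrongBad : ∀ {n} → Multigraph n → ℚ → Subset n → Set
StrongBad G κ X = Bad G κ X × InducedConnected G (∁ X)

Isolated : ∀ {n} → Multigraph n → ℚ → Fin n → Set
Isolated G κ x = Σ (Subset _) λ X → x ∈ X × Bad G κ X

StronglyIsolated : ∀ {n} → Multigraph n → ℚ → Fin n → Set
StronglyIsolated G κ x = Σ (Subset _) λ X → x ∈ X × StrongBad G κ X

Represents : ∀ {n} → Subset n → (Fin n → Set) → Set
Represents S P = ∀ x → (x ∈ S → P x) × (P x → x ∈ S)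

{-# OPTIONS --safe #-}
module Submission where

-- Let X be a κ²-bad set containing x and let C range over the connected components of G[V ∖ X].
-- If some C has vol C ≥ vol G / 2, then V ∖ C is a strong κ-bad set containing x: it is connected
-- because a walk from any of its vertices to x can be rerouted through X where it first meets C, its
-- complement C is connected, and every edge between C and V ∖ C has its other end in X, so that
-- e(V ∖ C, C) ≤ e(X, V ∖ X) < κ² vol X ≤ κ vol (V ∖ C).
-- Otherwise every component is small, so it is either strongly κ-bad, hence inside S = Isol⁺_κ, or
-- satisfies κ vol C ≤ e(C, V ∖ C) = e(C, X). Summing over the components gives
-- κ vol (V ∖ X) ≤ κ vol S + e(X, V ∖ X) < κ ε vol G + κ² vol X, which together with
-- vol X ≤ vol G / 2 contradicts κ + 2ε ≤ 1. The volume bound for Isol_{κ²} follows by inclusion.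

open import Defs
open import Data.Bool using (Bool; true; false; _∧_; not; if_then_else_)
open import Data.Bool.Properties using (∧-comm; ∧-conicalˡ; ∧-conicalʳ; not-involutive)
open import Data.Fin using (Fin; zero; suc)
open import Data.Fin.Properties using (any?) renaming (_≟_ to _≟ᶠ_)
open import Data.Fin.Subset using (Subset; _∈_; _∉_; _⊆_; ⁅_⁆; ∁; ⊤; _∩_; _∪_; ∣_∣)
open import Data.Fin.Subset.Properties
  using ( _∈?_; ∈⊤; x∈∁p⇒x∉p; x∉p⇒x∈∁p; x∉∁p⇒x∈p; x∈p∩q⁺; x∈p∩q⁻; p∩q⊆p; p∩q⊆q; ∩-identityˡ
        ; x∈⁅x⁆; x∈⁅y⁆⇒x≡y; x∈p∪q⁻; p⊆p∪q; q⊆p∪q; p⊂q⇒∣p∣<∣q∣; ∣p∣≤n )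
open import Data.Integer using (+_)
import Data.Integer as ℤ
import Data.Integer.Properties as ℤ
open import Data.List using (List; []; _∷_; allFin; filterᵇ; length; map)
open import Data.List.Membership.Propositional using () renaming (_∈_ to _∈ₗ_)
open import Data.List.Membership.Propositional.Properties using (∈-allFin)
open import Data.List.Relation.Unary.Any using (here; there)
open import Data.List.Relation.Unary.Any.Properties using (¬Any[])
import Data.List.Membership.DecPropositional as DecMembership
import Data.List.Properties as List
open import Data.Nat as ℕ using (ℕ; zero; suc; z≤n)
import Data.Nat.Properties as ℕ
open import Data.Nat.Coprimality using (1-coprimeTo) renaming (sym to coprime-sym)
open import Data.Nat.ListAction using (sum)
open import Data.Empty using (⊥; ⊥-elim)
open import Data.Product using (_×_; _,_; proj₁; proj₂; ∃; ∃₂; swap)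
open import Data.Product.Properties using (≡-dec)
import Data.Sum as Sum
open import Data.Sum using (inj₁; inj₂)
open import Data.Rational using (ℚ; mkℚ; 0ℚ; 1ℚ; _+_; _*_; _-_; _<_; _≤_; *≤*; nonNegative)
import Data.Rational.Properties as ℚ
open import Data.Rational.Solver using (module +-*-Solver)
open import Data.Vec using (tabulate)
import Data.Vec.Properties as Vec
open import Function using (_∘_; _$_; id)
open import Relation.Nullary using (Dec; yes; no; does; ¬_; ¬?)
open import Relation.Nullary.Decidable using (_×-dec_; _⊎-dec_; decidable-stable; dec-true; ¬¬-excluded-middle)
open import Relation.Binary.PropositionalEquality
open import Algebra.Properties.CommutativeSemigroup ℕ.+-commutativeSemigroup
  using () renaming (interchange to +-interchange)

module _ {A : Set} where

  sum-map-+ : ∀ (f g : A → ℕ) xs → sum (map (λ x → f x ℕ.+ g x) xs) ≡ sum (map f xs) ℕ.+ sum (map g xs)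
  sum-map-+ f g []       = refl
  sum-map-+ f g (x ∷ xs) = begin
    (f x ℕ.+ g x) ℕ.+ sum (map (λ x → f x ℕ.+ g x) xs)    ≡⟨ cong (f x ℕ.+ g x ℕ.+_) (sum-map-+ f g xs) ⟩
    (f x ℕ.+ g x) ℕ.+ (sum (map f xs) ℕ.+ sum (map g xs)) ≡⟨ +-interchange (f x) (g x) _ _ ⟩
    (f x ℕ.+ sum (map f xs)) ℕ.+ (g x ℕ.+ sum (map g xs)) ∎
    where open ≡-Reasoning

  sum-map-mono : ∀ {f g : A → ℕ} xs → (∀ {x} → x ∈ₗ xs → f x ℕ.≤ g x) → sum (map f xs) ℕ.≤ sum (map g xs)
  sum-map-mono []       f≤g = z≤n
  sum-map-mono (x ∷ xs) f≤g = ℕ.+-mono-≤ (f≤g (here refl)) (sum-map-mono xs (f≤g ∘ there))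

  sum-map-cong : ∀ {f g : A → ℕ} xs → (∀ x → f x ≡ g x) → sum (map f xs) ≡ sum (map g xs)
  sum-map-cong xs f≗g = cong sum (List.map-cong f≗g xs)

  sum-map-filterᵇ : ∀ (p : A → Bool) (f : A → ℕ) xs →
                    sum (map f (filterᵇ p xs)) ≡ sum (map (λ x → if p x then f x else 0) xs)
  sum-map-filterᵇ p f []       = refl
  sum-map-filterᵇ p f (x ∷ xs) with p x
  ... | true  = cong (f x ℕ.+_) (sum-map-filterᵇ p f xs)
  ... | false = sum-map-filterᵇ p f xs

  length-filterᵇ : ∀ (p : A → Bool) xs → length (filterᵇ p xs) ≡ sum (map (λ x → if p x then 1 else 0) xs)
  length-filterᵇ p []       = refl
  length-filterᵇ p (x ∷ xs) with p x
  ... | true  = cong ℕ.suc (length-filterᵇ p xs)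
  ... | false = length-filterᵇ p xs

∈-tail : ∀ {A : Set} {P : A → Set} {y : A} {L : List A} →
         ¬ P y → (∀ {x} → P x → x ∈ₗ y ∷ L) → ∀ {x} → P x → x ∈ₗ L
∈-tail ¬Py covered Px with covered Px
... | here refl = ⊥-elim (¬Py Px)
... | there x∈L = x∈L

if-split : ∀ a b k → (if a then k else 0) ≡ (if a ∧ b then k else 0) ℕ.+ (if a ∧ not b then k else 0)
if-split true  true  k = sym (ℕ.+-identityʳ k)
if-split true  false k = refl
if-split false b     k = refl

if-mono : ∀ {a b} k → (a ≡ true → b ≡ true) → (if a then k else 0) ℕ.≤ (if b then k else 0)
if-mono {false}        k a⇒b = z≤n
if-mono {true}  {true} k a⇒b = ℕ.≤-refl
if-mono {true}  {false} k a⇒b with () ← a⇒b refl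

if-split-∧ : ∀ a b c k →
             (if a ∧ c then k else 0) ≡ (if (a ∧ b) ∧ c then k else 0) ℕ.+ (if (a ∧ not b) ∧ c then k else 0)
if-split-∧ true  true  c k = sym (ℕ.+-identityʳ _)
if-split-∧ true  false c k = refl
if-split-∧ false b     c k = refl

module _ {n : ℕ} where

  mem-∈ : ∀ {S : Subset n} {x} → x ∈ S → mem S x ≡ true
  mem-∈ = Vec.[]=⇒lookup

  ∈-mem : ∀ {S : Subset n} {x} → mem S x ≡ true → x ∈ S
  ∈-mem {S} {x} = Vec.lookup⇒[]= x S

  mem-∩ : ∀ (A B : Subset n) x → mem (A ∩ B) x ≡ mem A x ∧ mem B x
  mem-∩ A B x = Vec.lookup-zipWith _∧_ x A B

  mem-∁ : ∀ (A : Subset n) x → mem (∁ A) x ≡ not (mem A x)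
  mem-∁ A x = Vec.lookup-map x not A

  ∁-involutive : ∀ (A : Subset n) → ∁ (∁ A) ≡ A
  ∁-involutive A = trans (sym (Vec.map-∘ not not A)) (trans (Vec.map-cong not-involutive A) (Vec.map-id A))

¬¬-decidable : ∀ {n} (P : Fin n → Set) → ¬ ¬ (∀ x → Dec (P x))
¬¬-decidable {zero}  P k = k λ ()
¬¬-decidable {suc n} P k = ¬¬-excluded-middle λ P0? → ¬¬-decidable (P ∘ suc) λ P? →
  k λ { zero → P0? ; (suc x) → P? x }

represented : ∀ {n} {P : Fin n → Set} → (∀ x → Dec (P x)) → ∃ λ S → Represents S P
represented {P = P} P? = S , λ x → sound x , complete x
  where
  S = tabulate (does ∘ P?)
  mem-S : ∀ x → mem S x ≡ does (P? x)
  mem-S = Vec.lookup∘tabulate (does ∘ P?)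
  sound : ∀ x → x ∈ S → P x
  sound x x∈S with P? x | trans (sym (mem-S x)) (mem-∈ x∈S)
  ... | yes Px | _ = Px
  ... | no _   | ()
  complete : ∀ x → P x → x ∈ S
  complete x Px = ∈-mem (trans (mem-S x) (dec-true (P? x) Px))

¬¬-represented : ∀ {n} (P : Fin n → Set) → ¬ ¬ (∃ λ S → Represents S P)
¬¬-represented P k = ¬¬-decidable P (k ∘ represented)

-- Volumes and edge counts

sum-orientedEdges : ∀ {n} (es : List (Fin n × Fin n)) (f : Fin n × Fin n → ℕ) →
                    sum (map f (orientedEdges (mkGraph es))) ≡ sum (map (λ e → f e ℕ.+ f (swap e)) es)
sum-orientedEdges []             f = refl
sum-orientedEdges ((u , v) ∷ es) f =
  trans (sym (ℕ.+-assoc (f (u , v)) (f (v , u)) _))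
        (cong (f (u , v) ℕ.+ f (v , u) ℕ.+_) (sum-orientedEdges es f))

∈-orientedEdges⇒Adj : ∀ {n} (G : Multigraph n) {a b} → (a , b) ∈ₗ orientedEdges G → Adj G a b
∈-orientedEdges⇒Adj (mkGraph (_ ∷ es)) (here refl)         = inj₁ (here refl)
∈-orientedEdges⇒Adj (mkGraph (_ ∷ es)) (there (here refl)) = inj₂ (here refl)
∈-orientedEdges⇒Adj (mkGraph (_ ∷ es)) (there (there a∈))  =
  Sum.map there there (∈-orientedEdges⇒Adj (mkGraph es) a∈)

module _ {n : ℕ} (G : Multigraph n) where

  vol≡sum : ∀ A → vol G A ≡ sum (map (λ x → if mem A x then deg G x else 0) (allFin n))
  vol≡sum A = sum-map-filterᵇ (mem A) (deg G) (allFin n)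

  vol-split : ∀ A B → vol G A ≡ vol G (A ∩ B) ℕ.+ vol G (A ∩ ∁ B)
  vol-split A B = begin
    vol G A
      ≡⟨ vol≡sum A ⟩
    sum (map (λ x → if mem A x then deg G x else 0) (allFin n))
      ≡⟨ sum-map-cong (allFin n) split ⟩
    sum (map (λ x → (if mem (A ∩ B) x then deg G x else 0) ℕ.+ (if mem (A ∩ ∁ B) x then deg G x else 0))
             (allFin n))
      ≡⟨ sum-map-+ _ _ (allFin n) ⟩
    sum (map (λ x → if mem (A ∩ B) x then deg G x else 0) (allFin n)) ℕ.+
    sum (map (λ x → if mem (A ∩ ∁ B) x then deg G x else 0) (allFin n))
      ≡⟨ sym (cong₂ ℕ._+_ (vol≡sum (A ∩ B)) (vol≡sum (A ∩ ∁ B))) ⟩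
    vol G (A ∩ B) ℕ.+ vol G (A ∩ ∁ B) ∎
    where
    open ≡-Reasoning
    split : ∀ x → (if mem A x then deg G x else 0)
                ≡ (if mem (A ∩ B) x then deg G x else 0) ℕ.+ (if mem (A ∩ ∁ B) x then deg G x else 0)
    split x rewrite mem-∩ A B x | mem-∩ A (∁ B) x | mem-∁ B x = if-split (mem A x) (mem B x) (deg G x)

  vol-∁ : ∀ A → vol G A ℕ.+ vol G (∁ A) ≡ volG G
  vol-∁ A = sym (trans (vol-split ⊤ A)
                       (cong₂ (λ B C → vol G B ℕ.+ vol G C) (∩-identityˡ A) (∩-identityˡ (∁ A))))

  vol-mono : ∀ {A B} → A ⊆ B → vol G A ℕ.≤ vol G B
  vol-mono {A} {B} A⊆B = subst₂ ℕ._≤_ (sym (vol≡sum A)) (sym (vol≡sum B))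
    (sum-map-mono (allFin n) λ {x} _ → if-mono (deg G x) (mem-∈ ∘ A⊆B ∘ ∈-mem))

  crossing : Subset n → Subset n → Fin n × Fin n → ℕ
  crossing X Y (a , b) = if mem X a ∧ mem Y b then 1 else 0

  eG≡sum : ∀ X Y → eG G X Y ≡ sum (map (crossing X Y) (orientedEdges G))
  eG≡sum X Y = trans (length-filterᵇ _ (orientedEdges G)) (sum-map-cong (orientedEdges G) λ { (a , b) → refl })

  e-split : ∀ U C Y → eG G U Y ≡ eG G (U ∩ C) Y ℕ.+ eG G (U ∩ ∁ C) Y
  e-split U C Y = begin
    eG G U Y
      ≡⟨ eG≡sum U Y ⟩
    sum (map (crossing U Y) (orientedEdges G))
      ≡⟨ sum-map-cong (orientedEdges G) split ⟩
    sum (map (λ e → crossing (U ∩ C) Y e ℕ.+ crossing (U ∩ ∁ C) Y e) (orientedEdges G))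
      ≡⟨ sum-map-+ _ _ (orientedEdges G) ⟩
    sum (map (crossing (U ∩ C) Y) (orientedEdges G)) ℕ.+ sum (map (crossing (U ∩ ∁ C) Y) (orientedEdges G))
      ≡⟨ sym (cong₂ ℕ._+_ (eG≡sum (U ∩ C) Y) (eG≡sum (U ∩ ∁ C) Y)) ⟩
    eG G (U ∩ C) Y ℕ.+ eG G (U ∩ ∁ C) Y ∎
    where
    open ≡-Reasoning
    split : ∀ e → crossing U Y e ≡ crossing (U ∩ C) Y e ℕ.+ crossing (U ∩ ∁ C) Y e
    split (a , b) rewrite mem-∩ U C a | mem-∩ U (∁ C) a | mem-∁ C a = if-split-∧ (mem U a) (mem C a) (mem Y b) 1

  e-comm : ∀ X Y → eG G X Y ≡ eG G Y X
  e-comm X Y = begin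
    eG G X Y
      ≡⟨ eG≡sum X Y ⟩
    sum (map (crossing X Y) (orientedEdges G))
      ≡⟨ sum-orientedEdges (edges G) _ ⟩
    sum (map (λ e → crossing X Y e ℕ.+ crossing X Y (swap e)) (edges G))
      ≡⟨ sum-map-cong (edges G) swap-crossings ⟩
    sum (map (λ e → crossing Y X e ℕ.+ crossing Y X (swap e)) (edges G))
      ≡⟨ sum-orientedEdges (edges G) _ ⟨
    sum (map (crossing Y X) (orientedEdges G))
      ≡⟨ eG≡sum Y X ⟨
    eG G Y X
      ∎
    where
    open ≡-Reasoning
    swap-crossings : ∀ e → crossing X Y e ℕ.+ crossing X Y (swap e) ≡ crossing Y X e ℕ.+ crossing Y X (swap e)
    swap-crossings (a , b) rewrite ∧-comm (mem X a) (mem Y b) | ∧-comm (mem X b) (mem Y a) =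
      ℕ.+-comm (crossing Y X (b , a)) (crossing Y X (a , b))

  e-mono : ∀ {X Y X′ Y′} → (∀ {a b} → Adj G a b → a ∈ X → b ∈ Y → a ∈ X′ × b ∈ Y′) → eG G X Y ℕ.≤ eG G X′ Y′
  e-mono {X} {Y} {X′} {Y′} moves = subst₂ ℕ._≤_ (sym (eG≡sum X Y)) (sym (eG≡sum X′ Y′))
    (sum-map-mono (orientedEdges G) λ { {a , b} e∈ → if-mono 1 (crossing-mono (∈-orientedEdges⇒Adj G e∈)) })
    where
    crossing-mono : ∀ {a b} → Adj G a b → mem X a ∧ mem Y b ≡ true → mem X′ a ∧ mem Y′ b ≡ true
    crossing-mono {a} {b} adj ab with moves adj (∈-mem (∧-conicalˡ _ _ ab)) (∈-mem (∧-conicalʳ _ _ ab))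
    ... | a∈X′ , b∈Y′ rewrite mem-∈ a∈X′ | mem-∈ b∈Y′ = refl

-- Walks and components

module _ {n : ℕ} (G : Multigraph n) where

  Adj-sym : ∀ {u v} → Adj G u v → Adj G v u
  Adj-sym = Sum.swap

  Adj? : ∀ u v → Dec (Adj G u v)
  Adj? u v = ((u , v) ∈ₗ? edges G) ⊎-dec ((v , u) ∈ₗ? edges G)
    where open DecMembership (≡-dec _≟ᶠ_ _≟ᶠ_) renaming (_∈?_ to _∈ₗ?_)

  reach-snoc : ∀ {A x y z} → Reach G A x y → Adj G y z → z ∈ A → Reach G A x z
  reach-snoc here             adj z∈A = step adj z∈A here
  reach-snoc (step a y∈A xy) adj z∈A = step a y∈A (reach-snoc xy adj z∈A)

  reach-trans : ∀ {A x y z} → Reach G A x y → Reach G A y z → Reach G A x z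
  reach-trans here             yz = yz
  reach-trans (step a w∈A wy) yz = step a w∈A (reach-trans wy yz)

  reach-sym : ∀ {A x y} → Reach G A x y → x ∈ A → Reach G A y x
  reach-sym here             x∈A = here
  reach-sym (step a w∈A wy) x∈A = reach-snoc (reach-sym wy w∈A) (Adj-sym a) x∈A

  reach-mono : ∀ {A B x y} → A ⊆ B → Reach G A x y → Reach G B x y
  reach-mono A⊆B here             = here
  reach-mono A⊆B (step a w∈A wy) = step a (A⊆B w∈A) (reach-mono A⊆B wy)

  Closed : Subset n → Subset n → Set
  Closed A U = ∀ {u w} → u ∈ U → Adj G u w → w ∈ A → w ∈ U

  reach-preserves : ∀ {A U x y} → Closed A U → Reach G A x y → x ∈ U → y ∈ U
  reach-preserves closed here             x∈U = x∈U
  reach-preserves closed (step a w∈A wy) x∈U = reach-preserves closed wy (closed x∈U a w∈A)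

  record Component (A : Subset n) (y : Fin n) : Set where
    field
      carrier   : Subset n
      source∈   : y ∈ carrier
      reachable : ∀ {z} → z ∈ carrier → Reach G A y z
      closed    : Closed A carrier

    reach-inside : ∀ {u z} → u ∈ carrier → Reach G A u z → Reach G carrier u z
    reach-inside u∈ here             = here
    reach-inside u∈ (step a w∈A wz) = step a (closed u∈ a w∈A) (reach-inside (closed u∈ a w∈A) wz)

    connected : InducedConnected G carrier
    connected a b a∈ b∈ =
      reach-trans (reach-sym (reach-inside source∈ (reachable a∈)) source∈)
                  (reach-inside source∈ (reachable b∈))

    least : ∀ {U} → y ∈ U → Closed A U → carrier ⊆ U
    least y∈U U-closed z∈ = reach-preserves U-closed (reachable z∈) y∈U

    carrier⊆ : y ∈ A → carrier ⊆ A
    carrier⊆ y∈A = least y∈A (λ _ _ w∈A → w∈A)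

  private
    Frontier : Subset n → Subset n → Set
    Frontier A R = ∃₂ λ u w → u ∈ R × Adj G u w × w ∈ A × w ∉ R

    frontier? : ∀ A R → Dec (Frontier A R)
    frontier? A R = any? λ u → any? λ w → (u ∈? R) ×-dec (Adj? u w ×-dec ((w ∈? A) ×-dec ¬? (w ∈? R)))

    grow : ∀ A y R k → y ∈ R → (∀ {z} → z ∈ R → Reach G A y z) → n ℕ.≤ ∣ R ∣ ℕ.+ k → Component A y
    grow A y R k y∈R reach fuel with frontier? A R
    ... | no none = record
      { carrier   = R
      ; source∈   = y∈R
      ; reachable = reach
      ; closed    = λ u∈R adj w∈A → decidable-stable (_ ∈? R) λ w∉R → none (_ , _ , u∈R , adj , w∈A , w∉R)
      }
    ... | yes (u , w , u∈R , adj , w∈A , w∉R) = grow′ k fuel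
      where
      R′ = R ∪ ⁅ w ⁆

      ∣R∣<∣R′∣ : ∣ R ∣ ℕ.< ∣ R′ ∣
      ∣R∣<∣R′∣ = p⊂q⇒∣p∣<∣q∣ (p⊆p∪q ⁅ w ⁆ , w , q⊆p∪q R ⁅ w ⁆ (x∈⁅x⁆ w) , w∉R)

      reach′ : ∀ {z} → z ∈ R′ → Reach G A y z
      reach′ z∈R′ with x∈p∪q⁻ R ⁅ w ⁆ z∈R′
      ... | inj₁ z∈R   = reach z∈R
      ... | inj₂ z∈⁅w⁆ rewrite x∈⁅y⁆⇒x≡y w z∈⁅w⁆ = reach-snoc (reach u∈R) adj w∈A

      grow′ : ∀ k → n ℕ.≤ ∣ R ∣ ℕ.+ k → Component A y
      grow′ zero    fuel = ⊥-elim (ℕ.<-irrefl refl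
        (ℕ.<-≤-trans ∣R∣<∣R′∣ (ℕ.≤-trans (∣p∣≤n R′) (ℕ.≤-trans fuel (ℕ.≤-reflexive (ℕ.+-identityʳ _))))))
      grow′ (suc k) fuel = grow A y R′ k (p⊆p∪q ⁅ w ⁆ y∈R) reach′
        (ℕ.≤-trans fuel (ℕ.≤-trans (ℕ.≤-reflexive (ℕ.+-suc _ k)) (ℕ.+-monoˡ-≤ k ∣R∣<∣R′∣)))

  component : ∀ A y → Component A y
  component A y =
    grow A y ⁅ y ⁆ n (x∈⁅x⁆ y) (λ z∈⁅y⁆ → subst (Reach G A y) (sym (x∈⁅y⁆⇒x≡y y z∈⁅y⁆)) here) (ℕ.m≤n+m n _)

ℕtoℚ-mkℚ : ∀ k → ℕtoℚ k ≡ mkℚ (+ k) 0 (coprime-sym (1-coprimeTo k))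
ℕtoℚ-mkℚ k = ℚ.↥p/↧p≡p (mkℚ (+ k) 0 (coprime-sym (1-coprimeTo k)))

ℕtoℚ-+ : ∀ a b → ℕtoℚ (a ℕ.+ b) ≡ ℕtoℚ a + ℕtoℚ b
ℕtoℚ-+ a b = sym (trans (cong₂ _+_ (ℕtoℚ-mkℚ a) (ℕtoℚ-mkℚ b))
  (ℚ./-cong (cong₂ ℤ._+_ (ℤ.*-identityʳ (+ a)) (ℤ.*-identityʳ (+ b))) refl))

ℕtoℚ-* : ∀ a b → ℕtoℚ (a ℕ.* b) ≡ ℕtoℚ a * ℕtoℚ b
ℕtoℚ-* a b = sym (trans (cong₂ _*_ (ℕtoℚ-mkℚ a) (ℕtoℚ-mkℚ b)) (ℚ./-cong (sym (ℤ.pos-* a b)) refl))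

ℕtoℚ-mono-≤ : ∀ {a b} → a ℕ.≤ b → ℕtoℚ a ≤ ℕtoℚ b
ℕtoℚ-mono-≤ {a} {b} a≤b rewrite ℕtoℚ-mkℚ a | ℕtoℚ-mkℚ b = *≤* (ℤ.*-monoʳ-≤-nonNeg (+ 1) (ℤ.+≤+ a≤b))

ℕtoℚ-nonNeg : ∀ a → 0ℚ ≤ ℕtoℚ a
ℕtoℚ-nonNeg a = ℕtoℚ-mono-≤ {0} {a} z≤n

complement-half : ∀ {m n o} → m ℕ.+ n ≡ o → o ℕ.≤ m ℕ.* 2 → n ℕ.* 2 ℕ.≤ o
complement-half {m} {n} {o} m+n≡o o≤2m = ℕ.+-cancelʳ-≤ o (n ℕ.* 2) o (begin
  n ℕ.* 2 ℕ.+ o         ≤⟨ ℕ.+-monoʳ-≤ (n ℕ.* 2) o≤2m ⟩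
  n ℕ.* 2 ℕ.+ m ℕ.* 2   ≡⟨ ℕ.*-distribʳ-+ 2 n m ⟨
  (n ℕ.+ m) ℕ.* 2       ≡⟨ cong (ℕ._* 2) (trans (ℕ.+-comm n m) m+n≡o) ⟩
  o ℕ.* 2               ≡⟨ ℕ.*-comm o 2 ⟩
  o ℕ.+ (o ℕ.+ 0)       ≡⟨ cong (o ℕ.+_) (ℕ.+-identityʳ o) ⟩
  o ℕ.+ o               ∎)
  where open ℕ.≤-Reasoning

*-monoˡ-≤-0≤ : ∀ {r p q} → 0ℚ ≤ r → p ≤ q → r * p ≤ r * q
*-monoˡ-≤-0≤ {r} 0≤r = ℚ.*-monoˡ-≤-nonNeg r {{nonNegative 0≤r}}

module _ where
  open ℚ.≤-Reasoning
  open +-*-Solver using (solve; _:=_; _:+_; _:*_; _:-_; con)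

  κ≤κ*3 : ∀ {κ} → 0ℚ ≤ κ → κ ≤ κ * ℕtoℚ 3
  κ≤κ*3 {κ} 0≤κ = begin
    κ             ≡⟨ solve 1 (λ k → k := k :+ con 0ℚ) refl κ ⟩
    κ + 0ℚ        ≤⟨ ℚ.+-monoʳ-≤ κ (ℚ.+-mono-≤ 0≤κ 0≤κ) ⟩
    κ + (κ + κ)   ≡⟨ solve 1 (λ k → k :+ (k :+ k) := k :* con (ℕtoℚ 3)) refl κ ⟩
    κ * ℕtoℚ 3    ∎

  3κ<1-2ε⇒κ+2ε≤1 : ∀ {κ ε} → 0ℚ ≤ κ → κ * ℕtoℚ 3 < 1ℚ - ℕtoℚ 2 * ε → κ + ℕtoℚ 2 * ε ≤ 1ℚ
  3κ<1-2ε⇒κ+2ε≤1 {κ} {ε} 0≤κ 3κ<1-2ε = ℚ.<⇒≤ (begin-strict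
    κ + ℕtoℚ 2 * ε                   ≤⟨ ℚ.+-monoˡ-≤ (ℕtoℚ 2 * ε) (κ≤κ*3 0≤κ) ⟩
    κ * ℕtoℚ 3 + ℕtoℚ 2 * ε          <⟨ ℚ.+-monoˡ-< (ℕtoℚ 2 * ε) 3κ<1-2ε ⟩
    (1ℚ - ℕtoℚ 2 * ε) + ℕtoℚ 2 * ε   ≡⟨ solve 1 (λ t → (con 1ℚ :- t) :+ t := con 1ℚ) refl (ℕtoℚ 2 * ε) ⟩
    1ℚ                               ∎)

  κ+2ε≤1⇒κ≤1 : ∀ {κ ε} → 0ℚ ≤ ε → κ + ℕtoℚ 2 * ε ≤ 1ℚ → κ ≤ 1ℚ
  κ+2ε≤1⇒κ≤1 {κ} {ε} 0≤ε κ+2ε≤1 = begin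
    κ                  ≡⟨ ℚ.+-identityʳ κ ⟨
    κ + 0ℚ             ≡⟨ cong (λ t → κ + t) (ℚ.*-zeroʳ (ℕtoℚ 2)) ⟨
    κ + ℕtoℚ 2 * 0ℚ    ≤⟨ ℚ.+-monoʳ-≤ κ (*-monoˡ-≤-0≤ (ℕtoℚ-nonNeg 2) 0≤ε) ⟩
    κ + ℕtoℚ 2 * ε     ≤⟨ κ+2ε≤1 ⟩
    1ℚ                 ∎

  κ²-ratio⇒κ-ratio : ∀ {κ a z e} → 0ℚ ≤ κ → κ ≤ 1ℚ → 0ℚ ≤ a → a ≤ z → e < κ * κ * a → e < κ * z
  κ²-ratio⇒κ-ratio {κ} {a} {z} {e} 0≤κ κ≤1 0≤a a≤z e<κκa = begin-strict
    e             <⟨ e<κκa ⟩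
    κ * κ * a     ≡⟨ ℚ.*-assoc κ κ a ⟩
    κ * (κ * a)   ≤⟨ *-monoˡ-≤-0≤ 0≤κ κa≤z ⟩
    κ * z         ∎
    where
    κa≤z : κ * a ≤ z
    κa≤z = begin
      κ * a    ≤⟨ ℚ.*-monoʳ-≤-nonNeg a {{nonNegative 0≤a}} κ≤1 ⟩
      1ℚ * a   ≡⟨ ℚ.*-identityˡ a ⟩
      a        ≤⟨ a≤z ⟩
      z        ∎

  scaled-+ : ∀ {κ} → 0ℚ ≤ κ → ∀ {a a₁ a₂ b b₁ b₂ c c₁ c₂} →
             a ℕ.≤ a₁ ℕ.+ a₂ → b₁ ℕ.+ b₂ ℕ.≤ b → c₁ ℕ.+ c₂ ℕ.≤ c →
             κ * ℕtoℚ a₁ ≤ κ * ℕtoℚ b₁ + ℕtoℚ c₁ → κ * ℕtoℚ a₂ ≤ κ * ℕtoℚ b₂ + ℕtoℚ c₂ →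
             κ * ℕtoℚ a ≤ κ * ℕtoℚ b + ℕtoℚ c
  scaled-+ {κ} 0≤κ {a} {a₁} {a₂} {b} {b₁} {b₂} {c} {c₁} {c₂} a≤ ≤b ≤c h₁ h₂ = begin
    κ * ℕtoℚ a
      ≤⟨ *-monoˡ-≤-0≤ 0≤κ (ℕtoℚ-mono-≤ a≤) ⟩
    κ * ℕtoℚ (a₁ ℕ.+ a₂)
      ≡⟨ cong (κ *_) (ℕtoℚ-+ a₁ a₂) ⟩
    κ * (ℕtoℚ a₁ + ℕtoℚ a₂)
      ≡⟨ ℚ.*-distribˡ-+ κ (ℕtoℚ a₁) (ℕtoℚ a₂) ⟩
    κ * ℕtoℚ a₁ + κ * ℕtoℚ a₂
      ≤⟨ ℚ.+-mono-≤ h₁ h₂ ⟩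
    (κ * ℕtoℚ b₁ + ℕtoℚ c₁) + (κ * ℕtoℚ b₂ + ℕtoℚ c₂)
      ≡⟨ solve 5 (λ k x y z w → (k :* x :+ y) :+ (k :* z :+ w) := k :* (x :+ z) :+ (y :+ w))
               refl κ (ℕtoℚ b₁) (ℕtoℚ c₁) (ℕtoℚ b₂) (ℕtoℚ c₂) ⟩
    κ * (ℕtoℚ b₁ + ℕtoℚ b₂) + (ℕtoℚ c₁ + ℕtoℚ c₂)
      ≡⟨ cong₂ (λ x y → κ * x + y) (ℕtoℚ-+ b₁ b₂) (ℕtoℚ-+ c₁ c₂) ⟨
    κ * ℕtoℚ (b₁ ℕ.+ b₂) + ℕtoℚ (c₁ ℕ.+ c₂)
      ≤⟨ ℚ.+-mono-≤ (*-monoˡ-≤-0≤ 0≤κ (ℕtoℚ-mono-≤ ≤b)) (ℕtoℚ-mono-≤ ≤c) ⟩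
    κ * ℕtoℚ b + ℕtoℚ c
      ∎

  complement-accounting-absurd : ∀ {κ ε a c s e} → 0ℚ ≤ κ → 0ℚ ≤ a → 0ℚ ≤ c → κ + ℕtoℚ 2 * ε ≤ 1ℚ →
                                 a * ℕtoℚ 2 ≤ a + c → s ≤ ε * (a + c) → e < κ * κ * a →
                                 κ * c ≤ κ * s + e → ⊥
  complement-accounting-absurd {κ} {ε} {a} {c} {s} {e} 0≤κ 0≤a 0≤c κ+2ε≤1 2a≤V s≤εV e<κκa κc≤κs+e =
    ℚ.<-irrefl refl 2V<2V
    where
    V = a + c
    two = ℕtoℚ 2

    c<κa+εV : c < κ * a + ε * V
    c<κa+εV = ℚ.*-cancelˡ-<-nonNeg κ {{nonNegative 0≤κ}} (begin-strict
      κ * c                      ≤⟨ κc≤κs+e ⟩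
      κ * s + e                  <⟨ ℚ.+-monoʳ-< (κ * s) e<κκa ⟩
      κ * s + κ * κ * a          ≤⟨ ℚ.+-monoˡ-≤ (κ * κ * a) (*-monoˡ-≤-0≤ 0≤κ s≤εV) ⟩
      κ * (ε * V) + κ * κ * a    ≡⟨ solve 4 (λ k e a V → k :* (e :* V) :+ k :* k :* a
                                                      := k :* (k :* a :+ e :* V)) refl κ ε a V ⟩
      κ * (κ * a + ε * V)        ∎)

    2V<2V : V * two < V * two
    2V<2V = begin-strict
      V * two
        ≡⟨ solve 2 (λ a c → (a :+ c) :* con two := a :* con two :+ c :* con two) refl a c ⟩
      a * two + c * two
        <⟨ ℚ.+-monoʳ-< (a * two) (ℚ.*-monoˡ-<-pos two c<κa+εV) ⟩
      a * two + (κ * a + ε * V) * two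
        ≡⟨ solve 4 (λ k e a V → a :* con two :+ (k :* a :+ e :* V) :* con two
                                := (con 1ℚ :+ k) :* (a :* con two) :+ V :* (con two :* e)) refl κ ε a V ⟩
      (1ℚ + κ) * (a * two) + V * (two * ε)
        ≤⟨ ℚ.+-monoˡ-≤ (V * (two * ε)) (*-monoˡ-≤-0≤ (ℚ.+-mono-≤ (ℕtoℚ-nonNeg 1) 0≤κ) 2a≤V) ⟩
      (1ℚ + κ) * V + V * (two * ε)
        ≡⟨ solve 3 (λ k e V → (con 1ℚ :+ k) :* V :+ V :* (con two :* e) := V :* (con 1ℚ :+ (k :+ con two :* e)))
                   refl κ ε V ⟩
      V * (1ℚ + (κ + two * ε))
        ≤⟨ *-monoˡ-≤-0≤ (ℚ.+-mono-≤ 0≤a 0≤c) (ℚ.+-monoʳ-≤ 1ℚ κ+2ε≤1) ⟩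
      V * two
        ∎

-- Components of the complement of a bad set

module ComplementComponents {n} (G : Multigraph n) (X : Subset n) where

  -- Opaque so that unification never unfolds the fuel-driven search in `component`.
  opaque
    K : ∀ y → Component G (∁ X) y
    K = component G (∁ X)

  C : Fin n → Subset n
  C y = Component.carrier (K y)

  C⊆∁X : ∀ {y} → y ∈ ∁ X → C y ⊆ ∁ X
  C⊆∁X = Component.carrier⊆ (K _)

  X⊆∁C : ∀ {y} → y ∈ ∁ X → X ⊆ ∁ (C y)
  X⊆∁C y∈∁X x∈X = x∉p⇒x∈∁p λ x∈C → x∈∁p⇒x∉p (C⊆∁X y∈∁X x∈C) x∈X

  exit∈X : ∀ {y u w} → u ∈ C y → Adj G u w → w ∉ C y → w ∈ X
  exit∈X u∈C adj w∉C = x∉∁p⇒x∈p (w∉C ∘ Component.closed (K _) u∈C adj)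

  closed-∖C : ∀ {U y} → U ⊆ ∁ X → Closed G (∁ X) U → Closed G (∁ X) (U ∩ ∁ (C y))
  closed-∖C {U} {y} U⊆∁X U-closed u∈U∖C adj w∈∁X =
    let u∈U , u∉C = x∈p∩q⁻ U (∁ (C y)) u∈U∖C in
    x∈p∩q⁺ (U-closed u∈U adj w∈∁X , x∉p⇒x∈∁p λ w∈C →
      x∈∁p⇒x∉p u∉C (Component.closed (K y) w∈C (Adj-sym G adj) (U⊆∁X u∈U)))

  ∁C-connected : Connected G → InducedConnected G X → ∀ {x₀ y} → x₀ ∈ X → y ∈ ∁ X → InducedConnected G (∁ (C y))
  ∁C-connected conn X-connected {x₀} {y} x₀∈X y∈∁X a b a∉C b∉C =
    reach-trans G (towards-x₀ (x∈∁p⇒x∉p a∉C) (conn a x₀ ∈⊤ ∈⊤))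
                  (reach-sym G (towards-x₀ (x∈∁p⇒x∉p b∉C) (conn b x₀ ∈⊤ ∈⊤)) b∉C)
    where
    towards-x₀ : ∀ {z} → z ∉ C y → Reach G ⊤ z x₀ → Reach G (∁ (C y)) z x₀
    towards-x₀ z∉C here = here
    towards-x₀ {z} z∉C (step {y = w} adj _ wx₀) with w ∈? C y
    ... | no  w∉C = step adj (x∉p⇒x∈∁p w∉C) (towards-x₀ w∉C wx₀)
    ... | yes w∈C = reach-mono G (X⊆∁C y∈∁X) (X-connected z x₀ (exit∈X w∈C (Adj-sym G adj) z∉C) x₀∈X)

  e-∁C-C≤e-X-∁X : ∀ {y} → y ∈ ∁ X → eG G (∁ (C y)) (C y) ℕ.≤ eG G X (∁ X)
  e-∁C-C≤e-X-∁X y∈∁X = e-mono G λ adj a∉C b∈C → exit∈X b∈C (Adj-sym G adj) (x∈∁p⇒x∉p a∉C) , C⊆∁X y∈∁X b∈C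

  e-C-∁C≤e-C-X : ∀ {y} → eG G (C y) (∁ (C y)) ℕ.≤ eG G (C y) X
  e-C-∁C≤e-C-X = e-mono G λ adj a∈C b∉C → a∈C , exit∈X a∈C adj (x∈∁p⇒x∉p b∉C)

-- Accounting for the volume outside a bad set

module Accounting {n} (G : Multigraph n) {κ : ℚ} (0≤κ : 0ℚ ≤ κ) (S X : Subset n) where

  record Accounted (U : Subset n) : Set where
    constructor accounted
    field
      bound : κ * ℕtoℚ (vol G U) ≤ κ * ℕtoℚ (vol G (U ∩ S)) + ℕtoℚ (eG G U X)

  open Accounted public

  accounted-⊆ : ∀ U → U ⊆ S → Accounted U
  accounted-⊆ U U⊆S = accounted $ begin
    κ * ℕtoℚ (vol G U)
      ≤⟨ *-monoˡ-≤-0≤ 0≤κ (ℕtoℚ-mono-≤ (vol-mono G λ x∈U → x∈p∩q⁺ (x∈U , U⊆S x∈U))) ⟩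
    κ * ℕtoℚ (vol G (U ∩ S))
      ≡⟨ ℚ.+-identityʳ (κ * ℕtoℚ (vol G (U ∩ S))) ⟨
    κ * ℕtoℚ (vol G (U ∩ S)) + 0ℚ
      ≤⟨ ℚ.+-monoʳ-≤ (κ * ℕtoℚ (vol G (U ∩ S))) (ℕtoℚ-nonNeg (eG G U X)) ⟩
    κ * ℕtoℚ (vol G (U ∩ S)) + ℕtoℚ (eG G U X)
      ∎
    where open ℚ.≤-Reasoning

  accounted-expanding : ∀ U → κ * ℕtoℚ (vol G U) ≤ ℕtoℚ (eG G U X) → Accounted U
  accounted-expanding U expanding = accounted $ begin
    κ * ℕtoℚ (vol G U)
      ≤⟨ expanding ⟩
    ℕtoℚ (eG G U X)
      ≡⟨ ℚ.+-identityˡ (ℕtoℚ (eG G U X)) ⟨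
    0ℚ + ℕtoℚ (eG G U X)
      ≡⟨ cong (_+ ℕtoℚ (eG G U X)) (ℚ.*-zeroʳ κ) ⟨
    κ * 0ℚ + ℕtoℚ (eG G U X)
      ≤⟨ ℚ.+-monoˡ-≤ (ℕtoℚ (eG G U X)) (*-monoˡ-≤-0≤ 0≤κ (ℕtoℚ-nonNeg (vol G (U ∩ S)))) ⟩
    κ * ℕtoℚ (vol G (U ∩ S)) + ℕtoℚ (eG G U X)
      ∎
    where open ℚ.≤-Reasoning

  accounted-split : ∀ U C → C ⊆ U → Accounted C → Accounted (U ∩ ∁ C) → Accounted U
  accounted-split U C C⊆U C-accounted U∖C-accounted = accounted (scaled-+ 0≤κ
    {vol G U} {vol G C} {vol G (U ∩ ∁ C)} {vol G (U ∩ S)} {vol G (C ∩ S)} {vol G ((U ∩ ∁ C) ∩ S)}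
    {eG G U X} {eG G C X} {eG G (U ∩ ∁ C) X} vol-U vol-U∩S e-U (bound C-accounted) (bound U∖C-accounted))
    where
    open ℕ.≤-Reasoning

    vol-U : vol G U ℕ.≤ vol G C ℕ.+ vol G (U ∩ ∁ C)
    vol-U = begin
      vol G U                               ≡⟨ vol-split G U C ⟩
      vol G (U ∩ C) ℕ.+ vol G (U ∩ ∁ C)     ≤⟨ ℕ.+-monoˡ-≤ _ (vol-mono G (p∩q⊆q U C)) ⟩
      vol G C ℕ.+ vol G (U ∩ ∁ C)           ∎

    C∩S⊆ : C ∩ S ⊆ (U ∩ S) ∩ C
    C∩S⊆ x∈ = let x∈C , x∈S = x∈p∩q⁻ C S x∈ in x∈p∩q⁺ (x∈p∩q⁺ (C⊆U x∈C , x∈S) , x∈C)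

    U∖C∩S⊆ : (U ∩ ∁ C) ∩ S ⊆ (U ∩ S) ∩ ∁ C
    U∖C∩S⊆ x∈ = let x∈U∖C , x∈S = x∈p∩q⁻ (U ∩ ∁ C) S x∈ ; x∈U , x∉C = x∈p∩q⁻ U (∁ C) x∈U∖C in
      x∈p∩q⁺ (x∈p∩q⁺ (x∈U , x∈S) , x∉C)

    vol-U∩S : vol G (C ∩ S) ℕ.+ vol G ((U ∩ ∁ C) ∩ S) ℕ.≤ vol G (U ∩ S)
    vol-U∩S = begin
      vol G (C ∩ S) ℕ.+ vol G ((U ∩ ∁ C) ∩ S)         ≤⟨ ℕ.+-mono-≤ (vol-mono G C∩S⊆) (vol-mono G U∖C∩S⊆) ⟩
      vol G ((U ∩ S) ∩ C) ℕ.+ vol G ((U ∩ S) ∩ ∁ C)   ≡⟨ vol-split G (U ∩ S) C ⟨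
      vol G (U ∩ S)                                   ∎

    e-U : eG G C X ℕ.+ eG G (U ∩ ∁ C) X ℕ.≤ eG G U X
    e-U = begin
      eG G C X ℕ.+ eG G (U ∩ ∁ C) X
        ≤⟨ ℕ.+-monoˡ-≤ _ (e-mono G {C} {X} {U ∩ C} {X} λ _ a∈C b∈X → x∈p∩q⁺ (C⊆U a∈C , a∈C) , b∈X) ⟩
      eG G (U ∩ C) X ℕ.+ eG G (U ∩ ∁ C) X
        ≡⟨ e-split G U C X ⟨
      eG G U X
        ∎

module ComponentAccounting {n} (G : Multigraph n) (X : Subset n) {κ : ℚ} (0≤κ : 0ℚ ≤ κ) (S : Subset n) where
  open ComplementComponents G X
  open Accounting G 0≤κ S X

  accounted-closed : (∀ {y} → y ∈ ∁ X → Accounted (C y)) →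
                     ∀ L U → U ⊆ ∁ X → Closed G (∁ X) U → (∀ {x} → x ∈ U → x ∈ₗ L) → Accounted U
  accounted-closed acc [] U U⊆∁X U-closed covered = accounted-⊆ U (⊥-elim ∘ ¬Any[] ∘ covered)
  accounted-closed acc (y ∷ L) U U⊆∁X U-closed covered = by-cases (y ∈? U)
    where
    by-cases : Dec (y ∈ U) → Accounted U
    by-cases (no y∉U)  = accounted-closed acc L U U⊆∁X U-closed (∈-tail y∉U covered)
    by-cases (yes y∈U) = accounted-split U (C y) (Component.least (K y) y∈U U-closed) (acc (U⊆∁X y∈U))
      (accounted-closed acc L (U ∩ ∁ (C y)) (U⊆∁X ∘ p∩q⊆p U (∁ (C y))) (closed-∖C U⊆∁X U-closed)
        (∈-tail (λ y∈U∖C → x∈∁p⇒x∉p (proj₂ (x∈p∩q⁻ U _ y∈U∖C)) (Component.source∈ (K y)))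
                (covered ∘ proj₁ ∘ x∈p∩q⁻ U _)))

  accounted-∁X : (∀ {y} → y ∈ ∁ X → Accounted (C y)) → Accounted (∁ X)
  accounted-∁X acc = accounted-closed acc (allFin n) (∁ X) id (λ _ _ w∈∁X → w∈∁X) (λ {x} _ → ∈-allFin x)

module Isolation {n} {G : Multigraph n} (conn : Connected G) {κ : ℚ} (0≤κ : 0ℚ ≤ κ) (κ≤1 : κ ≤ 1ℚ)
                 {X : Subset n} {x₀ : Fin n} (x₀∈X : x₀ ∈ X) (X-connected : InducedConnected G X)
                 (X-half : ℕtoℚ (vol G X) * ℕtoℚ 2 ≤ ℕtoℚ (volG G))
                 (X-sparse : ℕtoℚ (eG G X (∁ X)) < κ * κ * ℕtoℚ (vol G X)) where
  open ComplementComponents G X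

  ∁C-strongBad : ∀ {y} → y ∈ ∁ X → volG G ℕ.≤ vol G (C y) ℕ.* 2 → StrongBad G κ (∁ (C y))
  ∁C-strongBad {y} y∈∁X large = (∁C-connected conn X-connected x₀∈X y∈∁X , half , sparse) , connected
    where
    half : ℕtoℚ (vol G (∁ (C y))) * ℕtoℚ 2 ≤ ℕtoℚ (volG G)
    half = subst (_≤ ℕtoℚ (volG G)) (ℕtoℚ-* (vol G (∁ (C y))) 2)
      (ℕtoℚ-mono-≤ (complement-half {vol G (C y)} {vol G (∁ (C y))} (vol-∁ G (C y)) large))
    sparse : ℕtoℚ (eG G (∁ (C y)) (∁ (∁ (C y)))) < κ * ℕtoℚ (vol G (∁ (C y)))
    sparse = subst (λ Y → ℕtoℚ (eG G (∁ (C y)) Y) < κ * ℕtoℚ (vol G (∁ (C y)))) (sym (∁-involutive (C y)))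
      (ℚ.≤-<-trans (ℕtoℚ-mono-≤ (e-∁C-C≤e-X-∁X y∈∁X))
        (κ²-ratio⇒κ-ratio 0≤κ κ≤1 (ℕtoℚ-nonNeg (vol G X)) (ℕtoℚ-mono-≤ (vol-mono G (X⊆∁C y∈∁X))) X-sparse))
    connected : InducedConnected G (∁ (∁ (C y)))
    connected = subst (InducedConnected G) (sym (∁-involutive (C y))) (Component.connected (K y))

  C-strongBad : ∀ {y} → y ∈ ∁ X → vol G (C y) ℕ.* 2 ℕ.< volG G →
                ℕtoℚ (eG G (C y) (∁ (C y))) < κ * ℕtoℚ (vol G (C y)) → StrongBad G κ (C y)
  C-strongBad {y} y∈∁X small sparse =
    (Component.connected (K y) , half , sparse) , ∁C-connected conn X-connected x₀∈X y∈∁X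
    where
    half : ℕtoℚ (vol G (C y)) * ℕtoℚ 2 ≤ ℕtoℚ (volG G)
    half = subst (_≤ ℕtoℚ (volG G)) (ℕtoℚ-* (vol G (C y)) 2) (ℕtoℚ-mono-≤ (ℕ.<⇒≤ small))

  module _ {S : Subset n} (S-represents : Represents S (StronglyIsolated G κ)) where
    open Accounting G 0≤κ S X
    open ComponentAccounting G X 0≤κ S

    component-accounted : (∀ {y} → y ∈ ∁ X → vol G (C y) ℕ.* 2 ℕ.< volG G) → ∀ {y} → y ∈ ∁ X → Accounted (C y)
    component-accounted small {y} y∈∁X = by-cases (ℕtoℚ (eG G (C y) (∁ (C y))) ℚ.<? κ * ℕtoℚ (vol G (C y)))
      where
      by-cases : Dec (ℕtoℚ (eG G (C y) (∁ (C y))) < κ * ℕtoℚ (vol G (C y))) → Accounted (C y)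
      by-cases (yes sparse) = accounted-⊆ (C y) λ {z} z∈C →
        proj₂ (S-represents z) (C y , z∈C , C-strongBad y∈∁X (small y∈∁X) sparse)
      by-cases (no ¬sparse) = accounted-expanding (C y) (ℚ.≤-trans (ℚ.≮⇒≥ ¬sparse) (ℕtoℚ-mono-≤ e-C-∁C≤e-C-X))

    some-component-large : ∀ {ε} → κ + ℕtoℚ 2 * ε ≤ 1ℚ → ℕtoℚ (vol G S) ≤ ε * ℕtoℚ (volG G) →
                           ¬ (∀ {y} → y ∈ ∁ X → vol G (C y) ℕ.* 2 ℕ.< volG G)
    some-component-large {ε} κ+2ε≤1 S-small small =
      complement-accounting-absurd {κ} {ε} {a} {c} {s} {e}
        0≤κ (ℕtoℚ-nonNeg (vol G X)) (ℕtoℚ-nonNeg (vol G (∁ X))) κ+2ε≤1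
        (subst (a * ℕtoℚ 2 ≤_) V≡ X-half) (subst (λ V → s ≤ ε * V) V≡ S-small) X-sparse ∁X-accounted
      where
      open ℚ.≤-Reasoning
      a = ℕtoℚ (vol G X)
      c = ℕtoℚ (vol G (∁ X))
      s = ℕtoℚ (vol G S)
      e = ℕtoℚ (eG G X (∁ X))
      V≡ : ℕtoℚ (volG G) ≡ a + c
      V≡ = trans (cong ℕtoℚ (sym (vol-∁ G X))) (ℕtoℚ-+ (vol G X) (vol G (∁ X)))
      ∁X-accounted : κ * c ≤ κ * s + e
      ∁X-accounted = begin
        κ * c
          ≤⟨ bound (accounted-∁X (component-accounted small)) ⟩
        κ * ℕtoℚ (vol G (∁ X ∩ S)) + ℕtoℚ (eG G (∁ X) X)
          ≤⟨ ℚ.+-mono-≤ (*-monoˡ-≤-0≤ 0≤κ (ℕtoℚ-mono-≤ (vol-mono G (p∩q⊆q (∁ X) S))))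
                        (ℚ.≤-reflexive (cong ℕtoℚ (e-comm G (∁ X) X))) ⟩
        κ * s + e
          ∎

  strongly-isolated : ∀ {ε} → κ + ℕtoℚ 2 * ε ≤ 1ℚ →
                      (∀ S → Represents S (StronglyIsolated G κ) → ℕtoℚ (vol G S) ≤ ε * ℕtoℚ (volG G)) →
                      StronglyIsolated G κ x₀
  strongly-isolated {ε} κ+2ε≤1 small-isolation =
    by-cases (any? λ y → (y ∈? ∁ X) ×-dec (volG G ℕ.≤? vol G (C y) ℕ.* 2))
    where
    by-cases : Dec (∃ λ y → y ∈ ∁ X × volG G ℕ.≤ vol G (C y) ℕ.* 2) → StronglyIsolated G κ x₀
    by-cases (yes (y , y∈∁X , large)) = ∁ (C y) , X⊆∁C y∈∁X x₀∈X , ∁C-strongBad y∈∁X large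
    -- The set S exists only under a double negation, which suffices since this case is refuted.
    by-cases (no ¬large) = ⊥-elim (¬¬-represented (StronglyIsolated G κ) λ (S , S-represents) →
      some-component-large S-represents {ε} κ+2ε≤1 (small-isolation S S-represents)
        λ {y} y∈∁X → ℕ.≰⇒> λ large → ¬large (y , y∈∁X , large))

lemma6 : (ε κ : ℚ) → 0ℚ < ε → ε < 1ℚ → 0ℚ < κ
         → κ * ℕtoℚ 3 < 1ℚ - ℕtoℚ 2 * ε
         → κ < 1ℚ - ℕtoℚ 4 * ε
         → (n : ℕ) (G : Multigraph n) → Connected G
         → ((S : Subset n) → Represents S (StronglyIsolated G κ)
              → ℕtoℚ (vol G S) ≤ ε * ℕtoℚ (volG G))
         → ((x : _) → Isolated G (κ * κ) x → StronglyIsolated G κ x)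
           × ((S : Subset n) → Represents S (Isolated G (κ * κ))
              → ℕtoℚ (vol G S) ≤ ε * ℕtoℚ (volG G))
lemma6 ε κ 0<ε _ 0<κ 3κ<1-2ε _ n G conn small-isolation = isolated⇒strong , isolated-small
  where
  0≤κ : 0ℚ ≤ κ
  0≤κ = ℚ.<⇒≤ 0<κ
  κ+2ε≤1 : κ + ℕtoℚ 2 * ε ≤ 1ℚ
  κ+2ε≤1 = 3κ<1-2ε⇒κ+2ε≤1 {κ} {ε} 0≤κ 3κ<1-2ε

  isolated⇒strong : ∀ x → Isolated G (κ * κ) x → StronglyIsolated G κ x
  isolated⇒strong x (X , x∈X , X-connected , X-half , X-sparse) =
    Isolation.strongly-isolated conn 0≤κ (κ+2ε≤1⇒κ≤1 {κ} {ε} (ℚ.<⇒≤ 0<ε) κ+2ε≤1) x∈X X-connected X-half X-sparse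
      {ε} κ+2ε≤1 small-isolation

  isolated-small : ∀ S → Represents S (Isolated G (κ * κ)) → ℕtoℚ (vol G S) ≤ ε * ℕtoℚ (volG G)
  isolated-small S S-represents = decidable-stable (ℕtoℚ (vol G S) ℚ.≤? ε * ℕtoℚ (volG G)) λ ¬small →
    ¬¬-represented (StronglyIsolated G κ) λ (S′ , S′-represents) →
      ¬small (ℚ.≤-trans (ℕtoℚ-mono-≤ (vol-mono G λ {x} x∈S →
          proj₂ (S′-represents x) (isolated⇒strong x (proj₁ (S-represents x) x∈S))))
        (small-isolation S′ S′-represents))
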